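{- Let $l$ be a positive integer. Suppose that for each $1\le i\le l$ there exists a $(K_{i},F_{i},Z_{i},S_{i})$-PDA $\mathcal{P}_{i}$, and write $Z_{i}=F_{i}-g_{i}$. Then there exists a $(K,F,Z,S)$-PDA $\mathcal{P}$ with \[K=\prod_{i=1}^{l}K_{i},\quad F=\prod_{i=1}^{l}F_{i},\quad Z=\prod_{i=1}^{l}F_{i}-\prod_{i=1}^{l}g_{i},\quad S=\prod_{i=1}^{l}S_{i}.\]
   Context: A $(K,F,Z,S)$-PDA (placement delivery array) is an $F\times K$ array $\mathcal{P}=[p_{j,k}]$ whose entries are either a special symbol $*$ or integers from $\{1,\dots,S\}$, each integer in $\{1,\dots,S\}$ appearing at least once, such that: (A) the symbol $*$ appears exactly $Z$ times in each column; (B) no integer appears more than once in any row or any column; (C) for any two entries $p_{j_1,k_1}=p_{j_2,k_2}=s\in\{1,\dots,S\}$ with $j_1\ne j_2$ and $k_1\ne k_2$, we have $p_{j_1,k_2}=p_{j_2,k_1}=*$. -}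

module Defs where

open import Data.Nat using (ℕ; zero; suc; _*_)
open import Data.Fin using (Fin; zero; suc)
open import Data.Maybe using (Maybe; just; nothing; is-nothing)
open import Data.List using (List; length; filterᵇ)
open import Data.List using () renaming (allFin to allFinL)
open import Data.Product using (Σ; _×_; ∃; ∃-syntax)
open import Relation.Binary.PropositionalEquality using (_≡_; _≢_)

-- An entry of a PDA: nothing represents the symbol *, just s represents the
-- integer (toℕ s + 1) ∈ {1,…,S}.
Entry : ℕ → Set
Entry S = Maybe (Fin S)

Array : ℕ → ℕ → ℕ → Set
Array K F S = Fin F → Fin K → Entry S

starCount : ∀ {K F S} → Array K F S → Fin K → ℕ
starCount {F = F} P k = length (filterᵇ (λ j → is-nothing (P j k)) (allFinL F))

record IsPDA (K F Z S : ℕ) (P : Array K F S) : Set where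
  field
    every-int-appears : ∀ (s : Fin S) → ∃[ j ] ∃[ k ] (P j k ≡ just s)
    condA : ∀ (k : Fin K) → starCount P k ≡ Z
    condB-row : ∀ (j : Fin F) (k₁ k₂ : Fin K) (s : Fin S) →
      P j k₁ ≡ just s → P j k₂ ≡ just s → k₁ ≡ k₂
    condB-col : ∀ (k : Fin K) (j₁ j₂ : Fin F) (s : Fin S) →
      P j₁ k ≡ just s → P j₂ k ≡ just s → j₁ ≡ j₂
    condC : ∀ (j₁ j₂ : Fin F) (k₁ k₂ : Fin K) (s : Fin S) →
      j₁ ≢ j₂ → k₁ ≢ k₂ → P j₁ k₁ ≡ just s → P j₂ k₂ ≡ just s →
      (P j₁ k₂ ≡ nothing) × (P j₂ k₁ ≡ nothing)

PDAExists : ℕ → ℕ → ℕ → ℕ → Set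
PDAExists K F Z S = Σ (Array K F S) (IsPDA K F Z S)

prod : ∀ {l} → (Fin l → ℕ) → ℕ
prod {zero} f = 1
prod {suc l} f = f zero * prod (λ i → f (suc i))

-- Two PDAs are multiplied entrywise: rows, columns and symbols of the product
-- are pairs, and the entry at ((j₁ , j₂) , (k₁ , k₂)) is the pair of entries
-- P₁ j₁ k₁ and P₂ j₂ k₂ if both are integers, and * otherwise; iterating gives
-- the l-fold product. Conditions (B) and (C) hold componentwise: equal product
-- symbols have equal components, and distinct rows differ in some component,
-- where (C) of that factor produces a *. A column (k₁ , k₂) has an integer
-- exactly in the rows (j₁ , j₂) with integers in column k₁ of P₁ and in column
-- k₂ of P₂, so it has g₁ g₂ of them.
module Submission where

open import Defs
open import Data.Nat using (ℕ; zero; suc; _+_; _*_; _∸_; _≤_; z≤n; s≤s)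
open import Data.Nat.Properties
  using (+-suc; +-assoc; +-identityʳ; *-zeroʳ; *-distribʳ-+; *-mono-≤; m+n∸n≡m; m+n∸m≡n; m∸[m∸n]≡n; m∸n≤m)
open import Data.Bool using (Bool; true; false; not; _∧_; if_then_else_)
open import Data.Fin using (Fin; zero; suc; _↑ˡ_; _↑ʳ_; _≟_; combine; quotient; remainder)
open import Data.Fin.Properties using (remQuot-combine; combine-remQuot)
open import Data.Maybe using (Maybe; just; nothing; is-just; is-nothing; zipWith)
open import Data.List using (length; filterᵇ; tabulate)
open import Data.Product using (_×_; _,_; proj₁; proj₂; map)
open import Data.Empty using (⊥-elim)
open import Function using (_∘_; id)
open import Relation.Nullary using (yes; no)
open import Relation.Binary.PropositionalEquality

indicator : Bool → ℕ
indicator b = if b then 1 else 0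

count : ∀ {n} → (Fin n → Bool) → ℕ
count {zero}  p = 0
count {suc n} p = indicator (p zero) + count (p ∘ suc)

count-cong : ∀ {n} {p q : Fin n → Bool} → (∀ i → p i ≡ q i) → count p ≡ count q
count-cong {zero}  p≡q = refl
count-cong {suc n} p≡q = cong₂ _+_ (cong indicator (p≡q zero)) (count-cong (p≡q ∘ suc))

length-filterᵇ-tabulate : ∀ {A : Set} {n} (p : A → Bool) (f : Fin n → A) →
  length (filterᵇ p (tabulate f)) ≡ count (p ∘ f)
length-filterᵇ-tabulate {n = zero}  p f = refl
length-filterᵇ-tabulate {n = suc n} p f with p (f zero)
... | true  = cong suc (length-filterᵇ-tabulate p (f ∘ suc))
... | false = length-filterᵇ-tabulate p (f ∘ suc)

count-not+count : ∀ {n} (p : Fin n → Bool) → count (not ∘ p) + count p ≡ n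
count-not+count {zero}  p = refl
count-not+count {suc n} p with p zero
... | true  = trans (+-suc _ _) (cong suc (count-not+count (p ∘ suc)))
... | false = cong suc (count-not+count (p ∘ suc))

count-↑ : ∀ m n (p : Fin (m + n) → Bool) →
  count p ≡ count (p ∘ (_↑ˡ n)) + count (p ∘ (m ↑ʳ_))
count-↑ zero    n p = refl
count-↑ (suc m) n p =
  trans (cong (indicator (p zero) +_) (count-↑ m n (p ∘ suc)))
        (sym (+-assoc (indicator (p zero)) _ _))

count-∧ˡ : ∀ {n} b (q : Fin n → Bool) → count (λ j → b ∧ q j) ≡ indicator b * count q
count-∧ˡ {zero}  b     q = sym (*-zeroʳ (indicator b))
count-∧ˡ {suc n} true  q = sym (+-identityʳ (count q))
count-∧ˡ {suc n} false q = count-∧ˡ false (q ∘ suc)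

count-∧-combine : ∀ {m n} (p : Fin m → Bool) (q : Fin n → Bool) (h : Fin (m * n) → Bool) →
  (∀ i j → h (combine i j) ≡ p i ∧ q j) → count h ≡ count p * count q
count-∧-combine {zero}      p q h h≡ = refl
count-∧-combine {suc m} {n} p q h h≡ = begin
  count h
    ≡⟨ count-↑ n (m * n) h ⟩
  count (h ∘ (_↑ˡ m * n)) + count (h ∘ (n ↑ʳ_))
    ≡⟨ cong₂ _+_ (trans (count-cong (h≡ zero)) (count-∧ˡ (p zero) q))
                 (count-∧-combine (p ∘ suc) q (h ∘ (n ↑ʳ_)) (h≡ ∘ suc)) ⟩
  indicator (p zero) * count q + count (p ∘ suc) * count q
    ≡⟨ *-distribʳ-+ (count q) (indicator (p zero)) (count (p ∘ suc)) ⟨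
  count p * count q ∎
  where open ≡-Reasoning

is-just-zipWith : ∀ {A B C : Set} (f : A → B → C) (x : Maybe A) (y : Maybe B) →
  is-just (zipWith f x y) ≡ is-just x ∧ is-just y
is-just-zipWith f (just a) (just b) = refl
is-just-zipWith f (just a) nothing  = refl
is-just-zipWith f nothing  y        = refl

zipWith-nothingʳ : ∀ {A B C : Set} (f : A → B → C) (x : Maybe A) → zipWith f x nothing ≡ nothing
zipWith-nothingʳ f (just a) = refl
zipWith-nothingʳ f nothing  = refl

quotient-combine : ∀ {m n} (i : Fin m) (j : Fin n) → quotient {m} n (combine i j) ≡ i
quotient-combine i j = cong proj₁ (remQuot-combine i j)

remainder-combine : ∀ {m n} (i : Fin m) (j : Fin n) → remainder {m} n (combine i j) ≡ j
remainder-combine i j = cong proj₂ (remQuot-combine i j)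

quotient-remainder-injective : ∀ {m} n {x y : Fin (m * n)} →
  quotient {m} n x ≡ quotient n y → remainder {m} n x ≡ remainder {m} n y → x ≡ y
quotient-remainder-injective {m} n {x} {y} q≡ r≡ =
  trans (sym (combine-remQuot {m} n x)) (trans (cong₂ combine q≡ r≡) (combine-remQuot {m} n y))

zipWith-combine≡just : ∀ {m n} (x : Maybe (Fin m)) (y : Maybe (Fin n)) {s : Fin (m * n)} →
  zipWith combine x y ≡ just s → x ≡ just (quotient {m} n s) × y ≡ just (remainder {m} n s)
zipWith-combine≡just {m} {n} (just a) (just b) refl =
  cong just (sym (quotient-combine {m} {n} a b)) , cong just (sym (remainder-combine {m} {n} a b))

nonStarCount : ∀ {K F S} → Array K F S → Fin K → ℕ
nonStarCount P k = count (λ j → is-just (P j k))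

starCount+nonStarCount : ∀ {K F S} (P : Array K F S) k → starCount P k + nonStarCount P k ≡ F
starCount+nonStarCount P k =
  trans (cong (_+ nonStarCount P k) (length-filterᵇ-tabulate (λ j → is-nothing (P j k)) id))
        (count-not+count (λ j → is-just (P j k)))

starCount≡F∸nonStarCount : ∀ {K F S} (P : Array K F S) k → starCount P k ≡ F ∸ nonStarCount P k
starCount≡F∸nonStarCount P k = begin
  starCount P k                                      ≡⟨ m+n∸n≡m (starCount P k) (nonStarCount P k) ⟨
  starCount P k + nonStarCount P k ∸ nonStarCount P k ≡⟨ cong (_∸ nonStarCount P k) (starCount+nonStarCount P k) ⟩
  _ ∸ nonStarCount P k                               ∎
  where open ≡-Reasoning

module _ {K F Z S} {P : Array K F S} (isP : IsPDA K F Z S P) where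
  open IsPDA isP

  nonStarCount≡F∸Z : ∀ k → nonStarCount P k ≡ F ∸ Z
  nonStarCount≡F∸Z k = begin
    nonStarCount P k                  ≡⟨ m+n∸m≡n Z (nonStarCount P k) ⟨
    Z + nonStarCount P k ∸ Z           ≡⟨ cong (λ z → z + nonStarCount P k ∸ Z) (condA k) ⟨
    starCount P k + nonStarCount P k ∸ Z ≡⟨ cong (_∸ Z) (starCount+nonStarCount P k) ⟩
    F ∸ Z                             ∎
    where open ≡-Reasoning

  crossing-stars : ∀ {j j' k k' s} → j ≢ j' → P j k ≡ just s → P j' k' ≡ just s →
    P j k' ≡ nothing × P j' k ≡ nothing
  crossing-stars {j} {j'} {k} {k'} {s} j≢j' Pjk Pj'k' = condC j j' k k' s j≢j' k≢k' Pjk Pj'k'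
    where
    k≢k' : k ≢ k'
    k≢k' refl = j≢j' (condB-col k j j' s Pjk Pj'k')

_⊗_ : ∀ {K₁ F₁ S₁ K₂ F₂ S₂} → Array K₁ F₁ S₁ → Array K₂ F₂ S₂ →
  Array (K₁ * K₂) (F₁ * F₂) (S₁ * S₂)
_⊗_ {K₁} {F₁} {_} {K₂} {F₂} P₁ P₂ j k =
  zipWith combine (P₁ (quotient {F₁} F₂ j) (quotient {K₁} K₂ k))
                  (P₂ (remainder {F₁} F₂ j) (remainder {K₁} K₂ k))

module _ {K₁ F₁ S₁ K₂ F₂ S₂} (P₁ : Array K₁ F₁ S₁) (P₂ : Array K₂ F₂ S₂) where

  private
    row₁ : Fin (F₁ * F₂) → Fin F₁
    row₁ = quotient F₂
    row₂ : Fin (F₁ * F₂) → Fin F₂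
    row₂ = remainder {F₁} F₂
    col₁ : Fin (K₁ * K₂) → Fin K₁
    col₁ = quotient K₂
    col₂ : Fin (K₁ * K₂) → Fin K₂
    col₂ = remainder {K₁} K₂

  ⊗-combine-row : ∀ i₁ i₂ k →
    (P₁ ⊗ P₂) (combine i₁ i₂) k ≡ zipWith combine (P₁ i₁ (col₁ k)) (P₂ i₂ (col₂ k))
  ⊗-combine-row i₁ i₂ k =
    cong₂ (λ a b → zipWith combine (P₁ a (col₁ k)) (P₂ b (col₂ k)))
          (quotient-combine i₁ i₂) (remainder-combine i₁ i₂)

  ⊗-combine : ∀ j₁ j₂ k₁ k₂ →
    (P₁ ⊗ P₂) (combine j₁ j₂) (combine k₁ k₂) ≡ zipWith combine (P₁ j₁ k₁) (P₂ j₂ k₂)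
  ⊗-combine j₁ j₂ k₁ k₂ =
    trans (⊗-combine-row j₁ j₂ (combine k₁ k₂))
          (cong₂ (λ a b → zipWith combine (P₁ j₁ a) (P₂ j₂ b))
                 (quotient-combine k₁ k₂) (remainder-combine k₁ k₂))

  ⊗≡just : ∀ {j k s} → (P₁ ⊗ P₂) j k ≡ just s →
    P₁ (row₁ j) (col₁ k) ≡ just (quotient S₂ s) × P₂ (row₂ j) (col₂ k) ≡ just (remainder {S₁} S₂ s)
  ⊗≡just = zipWith-combine≡just _ _

  ⊗-nothingˡ : ∀ j k → P₁ (row₁ j) (col₁ k) ≡ nothing → (P₁ ⊗ P₂) j k ≡ nothing
  ⊗-nothingˡ j k e = cong (λ x → zipWith combine x (P₂ (row₂ j) (col₂ k))) e

  ⊗-nothingʳ : ∀ j k → P₂ (row₂ j) (col₂ k) ≡ nothing → (P₁ ⊗ P₂) j k ≡ nothing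
  ⊗-nothingʳ j k e =
    trans (cong (zipWith combine (P₁ (row₁ j) (col₁ k))) e) (zipWith-nothingʳ combine _)

  ⊗-nonStarCount : ∀ k → nonStarCount (P₁ ⊗ P₂) k ≡ nonStarCount P₁ (col₁ k) * nonStarCount P₂ (col₂ k)
  ⊗-nonStarCount k = count-∧-combine _ _ _ λ i₁ i₂ →
    trans (cong is-just (⊗-combine-row i₁ i₂ k)) (is-just-zipWith combine _ _)

  module _ {Z₁ Z₂} (I₁ : IsPDA K₁ F₁ Z₁ S₁ P₁) (I₂ : IsPDA K₂ F₂ Z₂ S₂ P₂) where
    open IsPDA

    ⊗-isPDA : IsPDA (K₁ * K₂) (F₁ * F₂) (F₁ * F₂ ∸ (F₁ ∸ Z₁) * (F₂ ∸ Z₂)) (S₁ * S₂) (P₁ ⊗ P₂)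
    ⊗-isPDA .every-int-appears s
      with j₁ , k₁ , e₁ ← every-int-appears I₁ (quotient S₂ s)
         | j₂ , k₂ , e₂ ← every-int-appears I₂ (remainder {S₁} S₂ s) =
      combine j₁ j₂ , combine k₁ k₂ ,
      trans (⊗-combine j₁ j₂ k₁ k₂)
            (trans (cong₂ (zipWith combine) e₁ e₂) (cong just (combine-remQuot {S₁} S₂ s)))
    ⊗-isPDA .condA k =
      trans (starCount≡F∸nonStarCount (P₁ ⊗ P₂) k)
            (cong (F₁ * F₂ ∸_) (trans (⊗-nonStarCount k)
              (cong₂ _*_ (nonStarCount≡F∸Z I₁ (col₁ k)) (nonStarCount≡F∸Z I₂ (col₂ k)))))
    ⊗-isPDA .condB-row j k k' s e e' = quotient-remainder-injective K₂
      (condB-row I₁ (row₁ j) (col₁ k) (col₁ k') _ (proj₁ (⊗≡just e)) (proj₁ (⊗≡just e')))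
      (condB-row I₂ (row₂ j) (col₂ k) (col₂ k') _ (proj₂ (⊗≡just e)) (proj₂ (⊗≡just e')))
    ⊗-isPDA .condB-col k j j' s e e' = quotient-remainder-injective F₂
      (condB-col I₁ (col₁ k) (row₁ j) (row₁ j') _ (proj₁ (⊗≡just e)) (proj₁ (⊗≡just e')))
      (condB-col I₂ (col₂ k) (row₂ j) (row₂ j') _ (proj₂ (⊗≡just e)) (proj₂ (⊗≡just e')))
    ⊗-isPDA .condC j j' k k' s j≢j' _ e e' with row₁ j ≟ row₁ j'
    ... | no row₁≢ = map (⊗-nothingˡ j k') (⊗-nothingˡ j' k)
      (crossing-stars I₁ row₁≢ (proj₁ (⊗≡just e)) (proj₁ (⊗≡just e')))
    ... | yes row₁≡ = map (⊗-nothingʳ j k') (⊗-nothingʳ j' k)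
      (crossing-stars I₂ (λ row₂≡ → j≢j' (quotient-remainder-injective F₂ row₁≡ row₂≡))
        (proj₂ (⊗≡just e)) (proj₂ (⊗≡just e')))

prod-cong : ∀ {l} {f g : Fin l → ℕ} → (∀ i → f i ≡ g i) → prod f ≡ prod g
prod-cong {zero}  f≡g = refl
prod-cong {suc l} f≡g = cong₂ _*_ (f≡g zero) (prod-cong (f≡g ∘ suc))

prod-mono-≤ : ∀ {l} {f g : Fin l → ℕ} → (∀ i → f i ≤ g i) → prod f ≤ prod g
prod-mono-≤ {zero}  f≤g = s≤s z≤n
prod-mono-≤ {suc l} f≤g = *-mono-≤ (f≤g zero) (prod-mono-≤ (f≤g ∘ suc))

singletonArray : Array 1 1 1
singletonArray _ _ = just zero

singleton-isPDA : IsPDA 1 1 0 1 singletonArray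
singleton-isPDA = record
  { every-int-appears = λ { zero → zero , zero , refl }
  ; condA             = λ { zero → refl }
  ; condB-row         = λ { zero zero zero _ _ _ → refl }
  ; condB-col         = λ { zero zero zero _ _ _ → refl }
  ; condC             = λ { zero zero _ _ _ j≢j' _ _ _ → ⊥-elim (j≢j' refl) }
  }

prod-PDAExists : ∀ {l} (K F Z S : Fin l → ℕ) → (∀ i → PDAExists (K i) (F i) (Z i) (S i)) →
  PDAExists (prod K) (prod F) (prod F ∸ prod (λ i → F i ∸ Z i)) (prod S)
prod-PDAExists {zero}  K F Z S pdas = singletonArray , singleton-isPDA
prod-PDAExists {suc l} K F Z S pdas
  with P₀ , I₀ ← pdas zero
     | P , I ← prod-PDAExists (K ∘ suc) (F ∘ suc) (Z ∘ suc) (S ∘ suc) (pdas ∘ suc) =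
  P₀ ⊗ P , subst (λ g → IsPDA _ _ (F zero * F′ ∸ (F zero ∸ Z zero) * g) _ (P₀ ⊗ P))
                 (m∸[m∸n]≡n (prod-mono-≤ λ i → m∸n≤m (F (suc i)) (Z (suc i))))
                 (⊗-isPDA P₀ P I₀ I)
  where F′ = prod (F ∘ suc)

theorem2 : (l : ℕ) → 1 ≤ l →
    (K F Z S g : Fin l → ℕ) →
    (∀ i → PDAExists (K i) (F i) (Z i) (S i)) →
    (∀ i → Z i + g i ≡ F i) →
    PDAExists (prod K) (prod F) (prod F ∸ prod g) (prod S)
theorem2 l _ K F Z S g pdas Z+g≡F =
  subst (λ G → PDAExists (prod K) (prod F) (prod F ∸ G) (prod S))
        (prod-cong F∸Z≡g) (prod-PDAExists K F Z S pdas)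
  where
  F∸Z≡g : ∀ i → F i ∸ Z i ≡ g i
  F∸Z≡g i = trans (cong (_∸ Z i) (sym (Z+g≡F i))) (m+n∸m≡n (Z i) (g i))
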